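{- Let $n\geq 2$ and $1\leq r\leq n$. Then for every vertex $v$ of $P_n^*$, \[|\mathcal{I}^{(r)}_v(P_n^*)|\leq |\mathcal{I}^{(r)}_{p_2}(P_n^*)| \quad\text{and}\quad |\mathcal{I}^{(r)}_v(P_n^*)|\leq |\mathcal{I}^{(r)}_{p_{n-1}}(P_n^*)|,\] i.e. the $r$-stars centred at $p_2$ and at $p_{n-1}$ are $r$-stars of maximum size in $P_n^*$.
   Context: $P_n$ is the path graph with vertices $x_1,\dots,x_n$ and edges $x_ix_{i+1}$ for $1\leq i\leq n-1$. The pendant graph $P_n^*$ has vertex set $\{x_1,\dots,x_n\}\sqcup\{p_1,\dots,p_n\}$ and edge set $E(P_n)\sqcup\{x_1p_1,\dots,x_np_n\}$. For a graph $H$, $\mathcal{I}^{(r)}(H)$ is the family of independent sets of size $r$ in $H$ and $\mathcal{I}^{(r)}_v(H)$ is the subfamily of those containing the vertex $v$ (the $r$-star centred at $v$). -}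

module Defs where

open import Data.Nat using (ℕ; zero; suc; _+_)
open import Data.Bool using (Bool; true; false; _∧_; not; if_then_else_)
open import Data.Fin using (Fin; toℕ)
open import Data.Fin.Subset using (Subset; inside; outside; ∣_∣)
open import Data.Vec using (_∷_; []; lookup)
open import Data.List using (List; []; _∷_; map; _++_; allFin; cartesianProduct)
open import Data.Product using (_×_; _,_)
open import Data.Nat using (_≡ᵇ_)

-- Vertices of the pendant graph P_n^* : x i (path vertices) and p i (pendants),
-- with i : Fin n, where Fin index i corresponds to the paper's subscript i+1.
data V (n : ℕ) : Set where
  x : Fin n → V n
  p : Fin n → V n

adj : {n : ℕ} → V n → V n → Bool
adj (x i) (x j) = (suc (toℕ i) ≡ᵇ toℕ j) Data.Bool.∨ (suc (toℕ j) ≡ᵇ toℕ i)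
adj (x i) (p j) = toℕ i ≡ᵇ toℕ j
adj (p i) (x j) = toℕ i ≡ᵇ toℕ j
adj (p i) (p j) = false

vertices : (n : ℕ) → List (V n)
vertices n = map x (allFin n) ++ map p (allFin n)

VSet : ℕ → Set
VSet n = Subset n × Subset n

_∈ᵇ_ : {n : ℕ} → V n → VSet n → Bool
x i ∈ᵇ (X , P) = lookup X i
p i ∈ᵇ (X , P) = lookup P i

size : {n : ℕ} → VSet n → ℕ
size (X , P) = ∣ X ∣ + ∣ P ∣

allSubsets : (n : ℕ) → List (Subset n)
allSubsets zero = [] ∷ []
allSubsets (suc n) = map (inside ∷_) (allSubsets n) ++ map (outside ∷_) (allSubsets n)

allVSets : (n : ℕ) → List (VSet n)
allVSets n = cartesianProduct (allSubsets n) (allSubsets n)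

allB : {A : Set} → (A → Bool) → List A → Bool
allB f [] = true
allB f (a ∷ as) = f a ∧ allB f as

independent : {n : ℕ} → VSet n → Bool
independent {n} S =
  allB (λ u → allB (λ w → not (adj u w ∧ (u ∈ᵇ S) ∧ (w ∈ᵇ S))) (vertices n)) (vertices n)

count : {A : Set} → (A → Bool) → List A → ℕ
count f [] = 0
count f (a ∷ as) = if f a then suc (count f as) else count f as

starSize : (n r : ℕ) → V n → ℕ
starSize n r v = count (λ S → independent S ∧ (size S ≡ᵇ r) ∧ (v ∈ᵇ S)) (allVSets n)

-- Encode a vertex set S of P_n^* by its columns (x_i ∈ S , p_i ∈ S), i = 0 … n-1 (the paper
-- numbers them from 1). S is independent iff no column is full and no two consecutive columns
-- both contain their path vertex, and |S| is the weight of the word, so a star is a set of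
-- words of fixed length and weight with a prescribed bit set. Stars are compared by
-- injections of such words: replacing x_k by p_k bounds the star at x_k by that at p_k;
-- reflecting the path exchanges p_k and p_(n-1-k); and reversing the columns before p_k and
-- reinserting p_k as second column (repaired when this makes two path vertices adjacent)
-- bounds the star at p_k by that at p_1. Composing them bounds every star by the star at p_1,
-- and via a reflection by the star at p_(n-2): the paper's p_2 and p_(n-1).

module Submission where

open import Defs
open import Algebra.Properties.CommutativeSemigroup using (interchange)
open import Data.Bool using (Bool; true; false; T; not; _∧_)
open import Data.Bool.Properties using (T-≡; T-∨)
open import Data.Empty using (⊥; ⊥-elim)
open import Data.Fin using (Fin; zero; suc; toℕ; fromℕ; inject₁)
open import Data.Fin.Properties using (toℕ-injective; toℕ-inject₁; toℕ-fromℕ; toℕ<n)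
open import Data.List using (List; []; _∷_; _++_; [_]; map; length; take; drop; reverse; _ʳ++_; head; last; allFin)
open import Data.List.Properties using (∷-injectiveˡ; ∷-injectiveʳ; length-++; length-ʳ++; length-reverse; ++-ʳ++; ʳ++-defn; reverse-involutive)
open import Data.List.Membership.Propositional using (_∈_)
open import Data.List.Membership.Propositional.Properties using (∈-∃++; ∈-map⁺; ∈-map⁻; ∈-++⁺ˡ; ∈-++⁺ʳ; ∈-allFin; ∈-cartesianProduct⁺)
open import Data.List.Relation.Unary.All as All using (All; []; _∷_)
import Data.List.Relation.Unary.All.Properties as All
open import Data.List.Relation.Unary.AllPairs using ([]; _∷_)
open import Data.List.Relation.Unary.Any using (here; there)
open import Data.List.Relation.Unary.Linked as Linked using (Linked; []; [-]; _∷_; _∷′_)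
import Data.List.Relation.Unary.Linked.Properties as Linked
open import Data.List.Relation.Unary.Unique.Propositional using (Unique)
import Data.List.Relation.Unary.Unique.Propositional.Properties as Unique
open import Data.Maybe using (just; nothing)
open import Data.Maybe.Relation.Binary.Connected as Connected using (Connected; just; just-nothing; nothing-just; nothing)
open import Data.Nat using (ℕ; zero; suc; _+_; _∸_; _≤_; _<_; z≤n; s≤s; _≡ᵇ_; _≟_)
open import Data.Nat.Properties
  using (≤-pred; m≤m+n; ≡ᵇ⇒≡; ≡⇒≡ᵇ; +-suc; +-assoc; +-comm; +-identityʳ; +-cancelˡ-≡; suc-injective; m+[n∸m]≡n; +-commutativeSemigroup; module ≤-Reasoning)
open import Data.Product using (_×_; _,_; proj₁; proj₂; ∃)
open import Data.Sum using (inj₁; inj₂)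
open import Data.Vec using ([]; _∷_; lookup; zip; toList)
import Data.Vec.Properties as Vec
open import Data.Vec.Properties using (length-toList)
open import Data.Fin.Subset using (Subset; ∣_∣)
open import Function using (_∘_; Equivalence)
open import Level using (0ℓ)
open import Relation.Binary using (Rel; Symmetric)
open import Relation.Binary.PropositionalEquality hiding ([_])
open import Relation.Nullary using (¬_; Dec; yes; no; does; _×-dec_; ¬?)
open import Relation.Nullary.Decidable using (dec-true; T?)
open import Relation.Unary using (Decidable)

-- Counting along injections

record _↪_ {A : Set} (P Q : A → Set) : Set where
  field
    to : A → A
    to-preserves : ∀ {a} → P a → Q (to a)
    to-injective : ∀ {a b} → P a → P b → to a ≡ to b → a ≡ b

open _↪_

↪-refl : {A : Set} {P : A → Set} → P ↪ P
↪-refl = record { to = λ a → a ; to-preserves = λ pa → pa ; to-injective = λ _ _ e → e }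

↪-trans : {A : Set} {P Q R : A → Set} → P ↪ Q → Q ↪ R → P ↪ R
↪-trans f g = record
  { to = to g ∘ to f
  ; to-preserves = to-preserves g ∘ to-preserves f
  ; to-injective = λ pa pb → to-injective f pa pb ∘ to-injective g (to-preserves f pa) (to-preserves f pb)
  }

↪-by-retraction : {A : Set} {P Q : A → Set} (f g : A → A) →
  (∀ {a} → P a → Q (f a)) → (∀ {a} → P a → g (f a) ≡ a) → P ↪ Q
↪-by-retraction f g preserves retract = record
  { to = f
  ; to-preserves = preserves
  ; to-injective = λ pa pb fa≡fb → trans (sym (retract pa)) (trans (cong g fa≡fb) (retract pb))
  }

count-++-∷ : {A : Set} (f : A → Bool) (us vs : List A) {y : A} → f y ≡ true →
  count f (us ++ y ∷ vs) ≡ suc (count f (us ++ vs))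
count-++-∷ f [] vs fy rewrite fy = refl
count-++-∷ f (u ∷ us) vs fy with f u
... | true = cong suc (count-++-∷ f us vs fy)
... | false = count-++-∷ f us vs fy

∈-++-∷⁻ : {A : Set} (us : List A) {vs : List A} {x y : A} → x ∈ us ++ y ∷ vs → x ≢ y → x ∈ us ++ vs
∈-++-∷⁻ [] (here x≡y) x≢y = ⊥-elim (x≢y x≡y)
∈-++-∷⁻ [] (there x∈) _ = x∈
∈-++-∷⁻ (u ∷ us) (here x≡u) _ = here x≡u
∈-++-∷⁻ (u ∷ us) (there x∈) x≢y = there (∈-++-∷⁻ us x∈ x≢y)

module _ {A : Set} {P Q : A → Set} (P? : Decidable P) (Q? : Decidable Q) (f : P ↪ Q) where

  count-≤-↪ : ∀ {L M} → Unique L → (∀ {a} → a ∈ L → P a → to f a ∈ M) →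
    count (does ∘ P?) L ≤ count (does ∘ Q?) M
  count-≤-↪ {[]} _ _ = z≤n
  count-≤-↪ {a ∷ L} (a∉L ∷ uniq) into with P? a
  ... | no _ = count-≤-↪ uniq (into ∘ there)
  ... | yes pa with ∈-∃++ (into (here refl) pa)
  ...   | us , vs , refl = begin
    suc (count (does ∘ P?) L)             ≤⟨ s≤s (count-≤-↪ uniq into′) ⟩
    suc (count (does ∘ Q?) (us ++ vs))    ≡⟨ sym (count-++-∷ (does ∘ Q?) us vs (dec-true (Q? _) (to-preserves f pa))) ⟩
    count (does ∘ Q?) (us ++ to f a ∷ vs) ∎
    where
    open ≤-Reasoning
    into′ : ∀ {b} → b ∈ L → P b → to f b ∈ us ++ vs
    into′ b∈L pb = ∈-++-∷⁻ us (into (there b∈L) pb)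
      (λ fb≡fa → All.lookup a∉L b∈L (sym (to-injective f pb pa fb≡fa)))

count-map : {A B : Set} (f : B → Bool) (g : A → B) (L : List A) → count f (map g L) ≡ count (f ∘ g) L
count-map f g [] = refl
count-map f g (a ∷ L) with f (g a)
... | true = cong suc (count-map f g L)
... | false = count-map f g L

count-cong : {A : Set} {f g : A → Bool} → (∀ a → f a ≡ g a) → (L : List A) → count f L ≡ count g L
count-cong f≗g [] = refl
count-cong f≗g (a ∷ L) rewrite f≗g a | count-cong f≗g L = refl

-- Words of columns

Column : Set
Column = Bool × Bool

Word : Set
Word = List Column

xOnly pOnly : Column
xOnly = true , false
pOnly = false , true

NotBoth : Bool → Bool → Set
NotBoth a b = ¬ (T a × T b)

ColumnOK : Column → Set
ColumnOK (a , b) = NotBoth a b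

XApart : Rel Column 0ℓ
XApart (a , _) (c , _) = NotBoth a c

Valid : Word → Set
Valid w = All ColumnOK w × Linked XApart w

notBoth? : ∀ a b → Dec (NotBoth a b)
notBoth? a b = ¬? (T? a ×-dec T? b)

valid? : Decidable Valid
valid? w = All.all? (λ (a , b) → notBoth? a b) w ×-dec Linked.linked? (λ (a , _) (c , _) → notBoth? a c) w

bit : Bool → ℕ
bit false = 0
bit true = 1

weight : Word → ℕ
weight [] = 0
weight ((a , b) ∷ w) = bit a + bit b + weight w

-- Out of range this is the empty column, which is ColumnOK and XApart from every column,
-- so lemmas about columnAt need no range hypotheses.
columnAt : ℕ → Word → Column
columnAt _ [] = false , false
columnAt zero (c ∷ _) = c
columnAt (suc k) (_ ∷ w) = columnAt k w

xAt pAt : ℕ → Word → Bool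
xAt k w = proj₁ (columnAt k w)
pAt k w = proj₂ (columnAt k w)

-- Star n r (memberAt v) encodes the star I^(r)_v(P_n^*); see starSize-≡.
Star : ℕ → ℕ → (Word → Bool) → Word → Set
Star n r at w = length w ≡ n × Valid w × weight w ≡ r × T (at w)

star? : ∀ n r at → Decidable (Star n r at)
star? n r at w = length w ≟ n ×-dec valid? w ×-dec weight w ≟ r ×-dec T? (at w)

data Split (k : ℕ) (c : Column) : Word → Set where
  split : ∀ A B → length A ≡ k → Split k c (A ++ c ∷ B)

columnAt-++ : ∀ A {c B} → columnAt (length A) (A ++ c ∷ B) ≡ c
columnAt-++ [] = refl
columnAt-++ (_ ∷ A) = columnAt-++ A

splitAt : ∀ {k} w → k < length w → ∃ λ c → Split k c w
splitAt {zero} (c ∷ w) _ = c , split [] w refl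
splitAt {suc k} (d ∷ w) (s≤s k<) with splitAt w k<
... | c , split A B refl = c , split (d ∷ A) B refl

xAt-< : ∀ k w → T (xAt k w) → k < length w
xAt-< zero (_ ∷ _) _ = s≤s z≤n
xAt-< (suc k) (_ ∷ w) t = s≤s (xAt-< k w t)

pAt-< : ∀ k w → T (pAt k w) → k < length w
pAt-< zero (_ ∷ _) _ = s≤s z≤n
pAt-< (suc k) (_ ∷ w) t = s≤s (pAt-< k w t)

ColumnOK-columnAt : ∀ k {w} → All ColumnOK w → ColumnOK (columnAt k w)
ColumnOK-columnAt _ [] = λ ()
ColumnOK-columnAt zero (ok ∷ _) = ok
ColumnOK-columnAt (suc k) (_ ∷ oks) = ColumnOK-columnAt k oks

XApart-columnAt : ∀ k {w} → Linked XApart w → XApart (columnAt k w) (columnAt (suc k) w)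
XApart-columnAt _ [] = λ ()
XApart-columnAt zero [-] = λ ()
XApart-columnAt (suc _) [-] = λ ()
XApart-columnAt zero (apart ∷ _) = apart
XApart-columnAt (suc k) (_ ∷ l) = XApart-columnAt k l

x-column : ∀ {c} → ColumnOK c → T (proj₁ c) → c ≡ xOnly
x-column {true , true} ok _ = ⊥-elim (ok _)
x-column {true , false} _ _ = refl

p-column : ∀ {c} → ColumnOK c → T (proj₂ c) → c ≡ pOnly
p-column {true , true} ok _ = ⊥-elim (ok _)
p-column {false , true} _ _ = refl

splitAt-x : ∀ {k w} → Valid w → T (xAt k w) → Split k xOnly w
splitAt-x {k} {w} (oks , _) t with splitAt w (xAt-< k w t)
... | c , split A B refl
    with x-column (All.head (All.++⁻ʳ A oks)) (subst (T ∘ proj₁) (columnAt-++ A) t)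
...   | refl = split A B refl

splitAt-p : ∀ {k w} → Valid w → T (pAt k w) → Split k pOnly w
splitAt-p {k} {w} (oks , _) t with splitAt w (pAt-< k w t)
... | c , split A B refl
    with p-column (All.head (All.++⁻ʳ A oks)) (subst (T ∘ proj₂) (columnAt-++ A) t)
...   | refl = split A B refl

Linked-++⁻ : {A : Set} {R : Rel A 0ℓ} (xs : List A) {ys : List A} →
  Linked R (xs ++ ys) → Linked R xs × Linked R ys
Linked-++⁻ [] l = [] , l
Linked-++⁻ (_ ∷ []) l = [-] , Linked.tail l
Linked-++⁻ (_ ∷ y ∷ xs) (r ∷ l) with Linked-++⁻ (y ∷ xs) l
... | l₁ , l₂ = r ∷ l₁ , l₂

Linked-ʳ++ : {A : Set} {R : Rel A 0ℓ} → Symmetric R → {xs ys : List A} →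
  Linked R xs → Linked R ys → Connected R (head xs) (head ys) → Linked R (xs ʳ++ ys)
Linked-ʳ++ sym {[]} _ lys _ = lys
Linked-ʳ++ sym {_ ∷ _} lxs lys c = Linked-ʳ++ sym (Linked.tail lxs) (c ∷′ lys) (Connected.sym sym (Linked.head′ lxs))

All-ʳ++ : {A : Set} {P : A → Set} {xs ys : List A} → All P xs → All P ys → All P (xs ʳ++ ys)
All-ʳ++ [] pys = pys
All-ʳ++ (px ∷ pxs) pys = All-ʳ++ pxs (px ∷ pys)

XApart-sym : Symmetric XApart
XApart-sym apart (a , c) = apart (c , a)

Valid-∷ : ∀ {c w} → ColumnOK c → Connected XApart (just c) (head w) → Valid w → Valid (c ∷ w)
Valid-∷ ok c~w (oks , l) = ok ∷ oks , c~w ∷′ l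

Valid-∷⁻ : ∀ {c w} → Valid (c ∷ w) → ColumnOK c × Valid w
Valid-∷⁻ (ok ∷ oks , l) = ok , oks , Linked.tail l

Valid-++⁺ : ∀ {A B} → Valid A → Valid B → Connected XApart (last A) (head B) → Valid (A ++ B)
Valid-++⁺ (oksA , lA) (oksB , lB) A~B = All.++⁺ oksA oksB , Linked.++⁺ lA A~B lB

Valid-++⁻ : ∀ A {B} → Valid (A ++ B) → Valid A × Valid B
Valid-++⁻ A (oks , l) with All.++⁻ A oks | Linked-++⁻ A l
... | oksA , oksB | lA , lB = (oksA , lA) , (oksB , lB)

Valid-++-∷⁻ : ∀ A {c B} → Valid (A ++ c ∷ B) → Valid A × Valid B
Valid-++-∷⁻ A v with Valid-++⁻ A v
... | vA , vcB = vA , proj₂ (Valid-∷⁻ vcB)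

Valid-ʳ++ : ∀ {A B} → Valid A → Valid B → Connected XApart (head A) (head B) → Valid (A ʳ++ B)
Valid-ʳ++ (oksA , lA) (oksB , lB) A~B = All-ʳ++ oksA oksB , Linked-ʳ++ (λ {c d} → XApart-sym {c} {d}) lA lB A~B

Valid-reverse : ∀ {w} → Valid w → Valid (reverse w)
Valid-reverse {[]} v = v
Valid-reverse {_ ∷ _} v = Valid-ʳ++ v ([] , []) just-nothing

pOnly-apartʳ : ∀ m → Connected XApart m (just pOnly)
pOnly-apartʳ nothing = nothing-just
pOnly-apartʳ (just _) = just (λ ())

pOnly-apartˡ : ∀ m → Connected XApart (just pOnly) m
pOnly-apartˡ nothing = just-nothing
pOnly-apartˡ (just _) = just (λ ())

Valid-pOnly∷ : ∀ {w} → Valid w → Valid (pOnly ∷ w)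
Valid-pOnly∷ {w} = Valid-∷ (λ ()) (pOnly-apartˡ (head w))

Valid-∷pOnly∷ : ∀ {c w} → ColumnOK c → Valid w → Valid (c ∷ pOnly ∷ w)
Valid-∷pOnly∷ ok v = Valid-∷ ok (just (λ ())) (Valid-pOnly∷ v)

Valid-setPendant : ∀ A {c B} → Valid (A ++ c ∷ B) → Valid (A ++ pOnly ∷ B)
Valid-setPendant A v with Valid-++-∷⁻ A v
... | vA , vB = Valid-++⁺ vA (Valid-pOnly∷ vB) (pOnly-apartʳ (last A))

length-++-∷ : {X : Set} (A : List X) {c : X} {B : List X} → length (A ++ c ∷ B) ≡ suc (length A + length B)
length-++-∷ [] = refl
length-++-∷ (_ ∷ A) = cong suc (length-++-∷ A)

++-injective : {X : Set} (A A′ : List X) {B B′ : List X} → length A ≡ length A′ → A ++ B ≡ A′ ++ B′ → A ≡ A′ × B ≡ B′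
++-injective [] [] _ e = refl , e
++-injective (_ ∷ A) (_ ∷ A′) eq e with ++-injective A A′ (suc-injective eq) (∷-injectiveʳ e) | ∷-injectiveˡ e
... | refl , refl | refl = refl , refl

ʳ++-injective : {X : Set} (A A′ : List X) {B B′ : List X} → length A ≡ length A′ → A ʳ++ B ≡ A′ ʳ++ B′ → A ≡ A′ × B ≡ B′
ʳ++-injective [] [] _ e = refl , e
ʳ++-injective (_ ∷ A) (_ ∷ A′) eq e with ʳ++-injective A A′ (suc-injective eq) e
... | refl , refl = refl , refl

weight-++ : ∀ A {B} → weight (A ++ B) ≡ weight A + weight B
weight-++ [] = refl
weight-++ ((a , b) ∷ A) {B} = trans (cong (bit a + bit b +_) (weight-++ A)) (sym (+-assoc (bit a + bit b) _ _))

weight-ʳ++ : ∀ A {B} → weight (A ʳ++ B) ≡ weight A + weight B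
weight-ʳ++ [] = refl
weight-ʳ++ ((a , b) ∷ A) {B} = begin
  weight (A ʳ++ (a , b) ∷ B)               ≡⟨ weight-ʳ++ A ⟩
  weight A + (bit a + bit b + weight B)    ≡⟨ sym (+-assoc (weight A) _ _) ⟩
  weight A + (bit a + bit b) + weight B    ≡⟨ cong (_+ weight B) (+-comm (weight A) _) ⟩
  bit a + bit b + weight A + weight B      ∎
  where open ≡-Reasoning

weight-reverse : ∀ w → weight (reverse w) ≡ weight w
weight-reverse w = trans (weight-ʳ++ w) (+-identityʳ (weight w))

-- Moving a pendant to column 1

afterFirst : Column → Word → Word
afterFirst c [] = [ c ]
afterFirst c (d ∷ w) = d ∷ c ∷ w

data Crowding : Word → Word → Set where
  crowded  : ∀ a A b B → Crowding ((true , a) ∷ A) ((true , b) ∷ B)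
  spacious : ∀ {A B} → Connected XApart (head A) (head B) → Crowding A B

crowding : ∀ A B → Crowding A B
crowding [] [] = spacious nothing
crowding [] (_ ∷ _) = spacious nothing-just
crowding (_ ∷ _) [] = spacious just-nothing
crowding ((false , _) ∷ _) (_ ∷ _) = spacious (just (λ ()))
crowding ((true , _) ∷ _) ((false , _) ∷ _) = spacious (just (λ ()))
crowding ((true , a) ∷ A) ((true , b) ∷ B) = crowded a A b B

-- toSecond A B is the image of A ++ pOnly ∷ B, whose pendant sits in column k = length A:
-- reverse A ++ B with the pendant inserted as second column. This puts x_0 next to x_(k+1),
-- so when both are present the image is instead x p x followed by the remaining columns in
-- order. Images of the first kind never start with x p x (afterFirst-uncrowded), which keeps
-- the map injective.
toSecond : Word → Word → Word
toSecond A B with crowding A B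
... | crowded _ A₂ _ B₂ = xOnly ∷ pOnly ∷ xOnly ∷ A₂ ++ B₂
... | spacious _ = afterFirst pOnly (A ʳ++ B)

xOnly-head : ∀ {a A} → Valid ((true , a) ∷ A) → (true , a) ≡ xOnly
xOnly-head v = x-column (proj₁ (Valid-∷⁻ v)) _

toSecond-length : ∀ A B → length (toSecond A B) ≡ suc (length A + length B)
toSecond-length A B with crowding A B
... | crowded _ A₂ _ _ = cong (2 +_) (trans (cong suc (length-++ A₂)) (sym (+-suc _ _)))
... | spacious _ = trans (length-afterFirst (A ʳ++ B)) (cong suc (length-ʳ++ A))
  where
  length-afterFirst : ∀ w → length (afterFirst pOnly w) ≡ suc (length w)
  length-afterFirst [] = refl
  length-afterFirst (_ ∷ _) = refl

toSecond-weight : ∀ {A B} → Valid A → Valid B → weight (toSecond A B) ≡ suc (weight A + weight B)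
toSecond-weight {A} {B} vA vB with crowding A B
... | spacious _ = trans (weight-afterFirst (A ʳ++ B)) (cong suc (weight-ʳ++ A))
  where
  weight-afterFirst : ∀ w → weight (afterFirst pOnly w) ≡ suc (weight w)
  weight-afterFirst [] = refl
  weight-afterFirst ((a , b) ∷ w) = +-suc (bit a + bit b) (weight w)
... | crowded _ A₂ _ _ with xOnly-head vA | xOnly-head vB
...   | refl | refl = cong (2 +_) (trans (cong suc (weight-++ A₂)) (sym (+-suc _ _)))

toSecond-valid : ∀ {A B} → Valid A → Valid B → Valid (toSecond A B)
toSecond-valid {A} {B} vA vB with crowding A B
... | spacious A~B = Valid-afterFirst (Valid-ʳ++ vA vB A~B)
  where
  Valid-afterFirst : ∀ {w} → Valid w → Valid (afterFirst pOnly w)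
  Valid-afterFirst {[]} _ = Valid-pOnly∷ ([] , [])
  Valid-afterFirst {_ ∷ _} v = Valid-∷pOnly∷ (proj₁ (Valid-∷⁻ v)) (proj₂ (Valid-∷⁻ v))
... | crowded _ _ _ _ with xOnly-head vA | xOnly-head vB
...   | refl | refl =
  Valid-∷pOnly∷ (λ ()) (Valid-++⁺ vA (proj₂ (Valid-∷⁻ vB)) (xOnly-before (Linked.head′ (proj₂ vB)) (last A)))
  where
  xOnly-before : ∀ {m} → Connected XApart (just xOnly) m → ∀ m′ → Connected XApart m′ m
  xOnly-before just-nothing nothing = nothing
  xOnly-before just-nothing (just _) = just-nothing
  xOnly-before (just apart) nothing = nothing-just
  xOnly-before (just apart) (just _) = just (λ (_ , t) → apart (_ , t))

toSecond-pAt1 : ∀ A B → 1 ≤ length A + length B → T (pAt 1 (toSecond A B))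
toSecond-pAt1 A B 1≤ with crowding A B
... | crowded _ _ _ _ = _
... | spacious _ = pAt1-afterFirst (A ʳ++ B) (subst (1 ≤_) (sym (length-ʳ++ A)) 1≤)
  where
  pAt1-afterFirst : ∀ w → 1 ≤ length w → T (pAt 1 (afterFirst pOnly w))
  pAt1-afterFirst (_ ∷ _) _ = _

afterFirst-injective : ∀ {c w w′} → afterFirst c w ≡ afterFirst c w′ → w ≡ w′
afterFirst-injective {w = []} {[]} _ = refl
afterFirst-injective {w = []} {_ ∷ []} ()
afterFirst-injective {w = []} {_ ∷ _ ∷ _} ()
afterFirst-injective {w = _ ∷ _} {[]} ()
afterFirst-injective {w = _ ∷ _} {_ ∷ _} refl = refl

afterFirst-uncrowded : ∀ {w u} → Valid w → afterFirst pOnly w ≢ xOnly ∷ pOnly ∷ xOnly ∷ u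
afterFirst-uncrowded {[]} _ ()
afterFirst-uncrowded {_ ∷ []} _ ()
afterFirst-uncrowded {_ ∷ _ ∷ _} (_ , l) refl = Linked.head l _

toSecond-injective : ∀ {A B A′ B′} → length A ≡ length A′ → Valid A → Valid B → Valid A′ → Valid B′ →
  toSecond A B ≡ toSecond A′ B′ → A ≡ A′ × B ≡ B′
toSecond-injective {A} {B} {A′} {B′} eq vA vB vA′ vB′ e with crowding A B | crowding A′ B′
... | spacious A~B | spacious _ = ʳ++-injective A A′ eq (afterFirst-injective e)
... | spacious A~B | crowded _ _ _ _ = ⊥-elim (afterFirst-uncrowded (Valid-ʳ++ vA vB A~B) e)
... | crowded _ _ _ _ | spacious A′~B′ = ⊥-elim (afterFirst-uncrowded (Valid-ʳ++ vA′ vB′ A′~B′) (sym e))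
... | crowded _ A₂ _ _ | crowded _ A₂′ _ _
    with xOnly-head vA | xOnly-head vB | xOnly-head vA′ | xOnly-head vB′ | ++-injective A₂ A₂′ (suc-injective eq) (cong (drop 3) e)
...   | refl | refl | refl | refl | refl , refl = refl , refl

-- Injections between stars

setColumn : ℕ → Column → Word → Word
setColumn _ _ [] = []
setColumn zero c (_ ∷ w) = c ∷ w
setColumn (suc k) c (d ∷ w) = d ∷ setColumn k c w

setColumn-++ : ∀ A {c d B} → setColumn (length A) d (A ++ c ∷ B) ≡ A ++ d ∷ B
setColumn-++ [] = refl
setColumn-++ (a ∷ A) = cong (a ∷_) (setColumn-++ A)

-- Replacing xOnly by pOnly keeps length and weight: both columns have weight 1.
setPendant-preserves : ∀ {n r k w} → Star n r (xAt k) w → Star n r (pAt k) (setColumn k pOnly w)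
setPendant-preserves (len , v , wt , xk) with splitAt-x v xk
... | split A B refl rewrite setColumn-++ A {xOnly} {pOnly} {B} =
  trans (trans (length-++-∷ A) (sym (length-++-∷ A))) len ,
  Valid-setPendant A v ,
  trans (trans (weight-++ A) (sym (weight-++ A))) wt ,
  subst (T ∘ proj₂) (sym (columnAt-++ A)) _

setPendant-retract : ∀ {n r k w} → Star n r (xAt k) w → setColumn k xOnly (setColumn k pOnly w) ≡ w
setPendant-retract (_ , v , _ , xk) with splitAt-x v xk
... | split A B refl rewrite setColumn-++ A {xOnly} {pOnly} {B} = setColumn-++ A

xAt↪pAt : ∀ {n r} k → Star n r (xAt k) ↪ Star n r (pAt k)
xAt↪pAt k = ↪-by-retraction (setColumn k pOnly) (setColumn k xOnly) setPendant-preserves setPendant-retract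

moveToSecond : ℕ → Word → Word
moveToSecond k w = toSecond (take k w) (drop (suc k) w)

moveToSecond-++ : ∀ A {c B k} → length A ≡ k → moveToSecond k (A ++ c ∷ B) ≡ toSecond A B
moveToSecond-++ A {c} {B} refl = cong₂ toSecond (take-++ A) (drop-++ A)
  where
  take-++ : ∀ A → take (length A) (A ++ c ∷ B) ≡ A
  take-++ [] = refl
  take-++ (a ∷ A) = cong (a ∷_) (take-++ A)
  drop-++ : ∀ A → drop (suc (length A)) (A ++ c ∷ B) ≡ B
  drop-++ [] = refl
  drop-++ (_ ∷ A) = drop-++ A

moveToSecond-preserves : ∀ {n r k w} → 2 ≤ n → Star n r (pAt k) w → Star n r (pAt 1) (moveToSecond k w)
moveToSecond-preserves 2≤n (len , v , wt , pk) with splitAt-p v pk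
... | split A B refl with Valid-++-∷⁻ A v
...   | vA , vB rewrite moveToSecond-++ A {pOnly} {B} refl =
  trans (toSecond-length A B) (trans (sym (length-++-∷ A)) len) ,
  toSecond-valid vA vB ,
  trans (toSecond-weight vA vB) (trans (sym (trans (weight-++ A) (+-suc _ _))) wt) ,
  toSecond-pAt1 A B (≤-pred (subst (2 ≤_) (trans (sym len) (length-++-∷ A)) 2≤n))

moveToSecond-injective : ∀ {n r k w w′} → Star n r (pAt k) w → Star n r (pAt k) w′ →
  moveToSecond k w ≡ moveToSecond k w′ → w ≡ w′
moveToSecond-injective (_ , v , _ , pk) (_ , v′ , _ , pk′) e with splitAt-p v pk | splitAt-p v′ pk′
... | split A B eq | split A′ B′ eq′ with Valid-++-∷⁻ A v | Valid-++-∷⁻ A′ v′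
...   | vA , vB | vA′ , vB′
      with toSecond-injective (trans eq (sym eq′)) vA vB vA′ vB′
             (trans (sym (moveToSecond-++ A eq)) (trans e (moveToSecond-++ A′ eq′)))
...     | refl , refl = refl

pAt↪second : ∀ {n r k} → 2 ≤ n → Star n r (pAt k) ↪ Star n r (pAt 1)
pAt↪second {k = k} 2≤n = record
  { to = moveToSecond k
  ; to-preserves = moveToSecond-preserves 2≤n
  ; to-injective = moveToSecond-injective
  }

columnAt-reverse : ∀ {k j} w → suc (k + j) ≡ length w → columnAt j (reverse w) ≡ columnAt k w
columnAt-reverse {k} {j} w len with splitAt w (subst (k <_) len (s≤s (m≤m+n k j)))
... | c , split A B refl = begin
  columnAt j (reverse (A ++ c ∷ B))                        ≡⟨ cong (columnAt j) (trans (++-ʳ++ A) (ʳ++-defn B)) ⟩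
  columnAt j (reverse B ++ c ∷ reverse A)                  ≡⟨ cong (λ i → columnAt i (reverse B ++ c ∷ reverse A)) j≡|B| ⟩
  columnAt (length (reverse B)) (reverse B ++ c ∷ reverse A) ≡⟨ columnAt-++ (reverse B) ⟩
  c                                                        ≡⟨ sym (columnAt-++ A) ⟩
  columnAt (length A) (A ++ c ∷ B)                         ∎
  where
  open ≡-Reasoning
  j≡|B| : j ≡ length (reverse B)
  j≡|B| = trans (+-cancelˡ-≡ (length A) _ _ (suc-injective (trans len (length-++-∷ A)))) (sym (length-reverse B))

reverse-preserves : ∀ {n r k j w} → suc (k + j) ≡ n → Star n r (pAt k) w → Star n r (pAt j) (reverse w)
reverse-preserves {w = w} k+j≡ (len , v , wt , pk) =
  trans (length-reverse w) len ,
  Valid-reverse v ,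
  trans (weight-reverse w) wt ,
  subst (T ∘ proj₂) (sym (columnAt-reverse w (trans k+j≡ (sym len)))) pk

pAt↪mirror : ∀ {n r k j} → suc (k + j) ≡ n → Star n r (pAt k) ↪ Star n r (pAt j)
pAt↪mirror k+j≡ = ↪-by-retraction reverse reverse (reverse-preserves k+j≡) (λ _ → reverse-involutive _)

-- Vertex sets of P_n^* as words

toWord : ∀ {n} → VSet n → Word
toWord (X , P) = toList (zip X P)

allWords : ℕ → List Word
allWords n = map toWord (allVSets n)

length-toWord : ∀ {n} (S : VSet n) → length (toWord S) ≡ n
length-toWord (X , P) = length-toList (zip X P)

columnAt-toWord : ∀ {n} (X P : Subset n) i → columnAt (toℕ i) (toWord (X , P)) ≡ (lookup X i , lookup P i)
columnAt-toWord (_ ∷ _) (_ ∷ _) zero = refl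
columnAt-toWord (_ ∷ X) (_ ∷ P) (suc i) = columnAt-toWord X P i

toWord-injective : ∀ {n} {S S′ : VSet n} → toWord S ≡ toWord S′ → S ≡ S′
toWord-injective {S = [] , []} {[] , []} _ = refl
toWord-injective {S = _ ∷ X , _ ∷ P} {_ ∷ X′ , _ ∷ P′} e
  with toWord-injective {S = X , P} {X′ , P′} (∷-injectiveʳ e) | ∷-injectiveˡ e
... | refl | refl = refl

toWord-surjective : ∀ {n} w → length w ≡ n → ∃ λ (S : VSet n) → toWord S ≡ w
toWord-surjective {zero} [] _ = ([] , []) , refl
toWord-surjective {suc n} ((a , b) ∷ w) len with toWord-surjective w (suc-injective len)
... | (X , P) , refl = (a ∷ X , b ∷ P) , refl

allSubsets-unique : ∀ n → Unique (allSubsets n)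
allSubsets-unique zero = [] ∷ []
allSubsets-unique (suc n) =
  Unique.++⁺ (Unique.map⁺ Vec.∷-injectiveʳ (allSubsets-unique n)) (Unique.map⁺ Vec.∷-injectiveʳ (allSubsets-unique n)) disjoint
  where
  disjoint : ∀ {X} → X ∈ map (true ∷_) (allSubsets n) × X ∈ map (false ∷_) (allSubsets n) → ⊥
  disjoint (X∈ , X∈′) with ∈-map⁻ _ X∈ | ∈-map⁻ _ X∈′
  ... | _ , _ , refl | _ , _ , ()

∈-allSubsets : ∀ {n} (X : Subset n) → X ∈ allSubsets n
∈-allSubsets [] = here refl
∈-allSubsets (true ∷ X) = ∈-++⁺ˡ (∈-map⁺ _ (∈-allSubsets X))
∈-allSubsets (false ∷ X) = ∈-++⁺ʳ _ (∈-map⁺ _ (∈-allSubsets X))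

allWords-unique : ∀ n → Unique (allWords n)
allWords-unique n = Unique.map⁺ toWord-injective (Unique.cartesianProduct⁺ (allSubsets-unique n) (allSubsets-unique n))

∈-allWords : ∀ {n w} → length w ≡ n → w ∈ allWords n
∈-allWords {w = w} len with toWord-surjective w len
... | (X , P) , refl = ∈-map⁺ toWord (∈-cartesianProduct⁺ (∈-allSubsets X) (∈-allSubsets P))


Independent : ∀ {n} → VSet n → Set
Independent S = ∀ u v → T (adj u v) → NotBoth (u ∈ᵇ S) (v ∈ᵇ S)

allB-sound : {A : Set} {f : A → Bool} {a : A} (L : List A) → T (allB f L) → a ∈ L → T (f a)
allB-sound {f = f} (b ∷ L) t (here refl) with f b
... | true = _
allB-sound {f = f} (b ∷ L) t (there a∈L) with f b
... | true = allB-sound L t a∈L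

allB-complete : {A : Set} {f : A → Bool} (L : List A) → (∀ {a} → a ∈ L → T (f a)) → T (allB f L)
allB-complete [] _ = _
allB-complete {f = f} (b ∷ L) h with f b | h (here refl)
... | true | _ = allB-complete L (h ∘ there)

T-not-∧₃⁻ : ∀ {a b c} → T (not (a ∧ b ∧ c)) → ¬ (T a × T b × T c)
T-not-∧₃⁻ {true} {true} {true} ()

T-not-∧₃⁺ : ∀ {a b c} → ¬ (T a × T b × T c) → T (not (a ∧ b ∧ c))
T-not-∧₃⁺ {true} {true} {true} h = h _
T-not-∧₃⁺ {true} {true} {false} _ = _
T-not-∧₃⁺ {true} {false} _ = _
T-not-∧₃⁺ {false} _ = _

∈-vertices : ∀ {n} (v : V n) → v ∈ vertices n
∈-vertices (x i) = ∈-++⁺ˡ (∈-map⁺ x (∈-allFin i))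
∈-vertices {n} (p i) = ∈-++⁺ʳ (map x (allFin n)) (∈-map⁺ p (∈-allFin i))

independent⇒Independent : ∀ {n} {S : VSet n} → T (independent S) → Independent S
independent⇒Independent {n} t u v uv uv∈ =
  T-not-∧₃⁻ (allB-sound (vertices n) (allB-sound (vertices n) t (∈-vertices u)) (∈-vertices v)) (uv , uv∈)

Independent⇒independent : ∀ {n} {S : VSet n} → Independent S → T (independent S)
Independent⇒independent {n} ind = allB-complete (vertices n) λ {u} _ → allB-complete (vertices n) λ {v} _ →
  T-not-∧₃⁺ (λ (uv , uv∈) → ind u v uv uv∈)

Independent-tail : ∀ {n a b} {X P : Subset n} → Independent (a ∷ X , b ∷ P) → Independent (X , P)
Independent-tail ind (x i) (x j) = ind (x (suc i)) (x (suc j))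
Independent-tail ind (x i) (p j) = ind (x (suc i)) (p (suc j))
Independent-tail ind (p i) (x j) = ind (p (suc i)) (x (suc j))
Independent-tail ind (p i) (p j) = ind (p (suc i)) (p (suc j))

Independent⇒Valid : ∀ {n} (S : VSet n) → Independent S → Valid (toWord S)
Independent⇒Valid ([] , []) _ = [] , []
Independent⇒Valid (_ ∷ [] , _ ∷ []) ind = Valid-∷ (ind (x zero) (p zero) _) just-nothing ([] , [])
Independent⇒Valid (_ ∷ c ∷ X , _ ∷ d ∷ P) ind =
  Valid-∷ (ind (x zero) (p zero) _) (just (ind (x zero) (x (suc zero)) _))
          (Independent⇒Valid (c ∷ X , d ∷ P) (Independent-tail ind))

Valid⇒NotBoth-xp : ∀ {n} {X P : Subset n} → Valid (toWord (X , P)) → ∀ i → NotBoth (lookup X i) (lookup P i)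
Valid⇒NotBoth-xp {X = X} {P} (oks , _) i = subst ColumnOK (columnAt-toWord X P i) (ColumnOK-columnAt (toℕ i) oks)

Valid⇒NotBoth-xx : ∀ {n} {X P : Subset n} → Valid (toWord (X , P)) → ∀ i j → suc (toℕ i) ≡ toℕ j → NotBoth (lookup X i) (lookup X j)
Valid⇒NotBoth-xx {X = X} {P} (_ , l) i j i+1≡j = subst₂ NotBoth (cong proj₁ (columnAt-toWord X P i))
  (trans (cong (λ k → xAt k (toWord (X , P))) i+1≡j) (cong proj₁ (columnAt-toWord X P j)))
  (XApart-columnAt (toℕ i) l)

Valid⇒Independent : ∀ {n} (S : VSet n) → Valid (toWord S) → Independent S
Valid⇒Independent S v (x i) (x j) e with Equivalence.to T-∨ e
... | inj₁ i+1≡j = Valid⇒NotBoth-xx v i j (≡ᵇ⇒≡ _ _ i+1≡j)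
... | inj₂ j+1≡i = λ (xi , xj) → Valid⇒NotBoth-xx v j i (≡ᵇ⇒≡ _ _ j+1≡i) (xj , xi)
Valid⇒Independent (X , P) v (x i) (p j) e =
  subst (λ i → NotBoth (lookup X i) (lookup P j)) (toℕ-injective (sym (≡ᵇ⇒≡ _ _ e))) (Valid⇒NotBoth-xp v j)
Valid⇒Independent (X , P) v (p i) (x j) e =
  subst (λ j → NotBoth (lookup P i) (lookup X j)) (toℕ-injective (≡ᵇ⇒≡ _ _ e)) (λ (pi , xi) → Valid⇒NotBoth-xp v i (xi , pi))

does-≡ : ∀ {b : Bool} {P : Set} (P? : Dec P) → (T b → P) → (P → T b) → b ≡ does P?
does-≡ {true} (yes _) _ _ = refl
does-≡ {true} (no ¬p) to _ = ⊥-elim (¬p (to _))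
does-≡ {false} (yes holds) _ from = ⊥-elim (from holds)
does-≡ {false} (no _) _ _ = refl

independent-≡ : ∀ {n} (S : VSet n) → independent S ≡ does (valid? (toWord S))
independent-≡ S = does-≡ (valid? (toWord S)) (Independent⇒Valid S ∘ independent⇒Independent)
                                              (Independent⇒independent ∘ Valid⇒Independent S)

memberAt : ∀ {n} → V n → Word → Bool
memberAt (x i) = xAt (toℕ i)
memberAt (p i) = pAt (toℕ i)

memberAt-toWord : ∀ {n} (v : V n) (S : VSet n) → memberAt v (toWord S) ≡ v ∈ᵇ S
memberAt-toWord (x i) (X , P) = cong proj₁ (columnAt-toWord X P i)
memberAt-toWord (p i) (X , P) = cong proj₂ (columnAt-toWord X P i)

∣∷∣ : ∀ {n} a (X : Subset n) → ∣ a ∷ X ∣ ≡ bit a + ∣ X ∣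
∣∷∣ true _ = refl
∣∷∣ false _ = refl

weight-toWord : ∀ {n} (S : VSet n) → weight (toWord S) ≡ size S
weight-toWord ([] , []) = refl
weight-toWord (a ∷ X , b ∷ P) = begin
  bit a + bit b + weight (toWord (X , P)) ≡⟨ cong (bit a + bit b +_) (weight-toWord (X , P)) ⟩
  bit a + bit b + (∣ X ∣ + ∣ P ∣)         ≡⟨ interchange +-commutativeSemigroup (bit a) (bit b) ∣ X ∣ ∣ P ∣ ⟩
  bit a + ∣ X ∣ + (bit b + ∣ P ∣)         ≡⟨ sym (cong₂ _+_ (∣∷∣ a X) (∣∷∣ b P)) ⟩
  ∣ a ∷ X ∣ + ∣ b ∷ P ∣                   ∎
  where open ≡-Reasoning

starSize-≡ : ∀ n r (v : V n) → starSize n r v ≡ count (does ∘ star? n r (memberAt v)) (allWords n)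
starSize-≡ n r v = trans (count-cong star-test (allVSets n)) (sym (count-map _ toWord (allVSets n)))
  where
  star-test : ∀ S → independent S ∧ (size S ≡ᵇ r) ∧ (v ∈ᵇ S) ≡ does (star? n r (memberAt v) (toWord S))
  star-test S = begin
    independent S ∧ (size S ≡ᵇ r) ∧ (v ∈ᵇ S)
      ≡⟨ cong₂ _∧_ (independent-≡ S) (cong₂ _∧_ (cong (_≡ᵇ r) (sym (weight-toWord S))) (sym (memberAt-toWord v S))) ⟩
    does (valid? w) ∧ (weight w ≡ᵇ r) ∧ memberAt v w
      ≡⟨ cong (_∧ (does (valid? w) ∧ (weight w ≡ᵇ r) ∧ memberAt v w)) (sym (Equivalence.to T-≡ (≡⇒≡ᵇ _ _ (length-toWord S)))) ⟩
    (length w ≡ᵇ n) ∧ does (valid? w) ∧ (weight w ≡ᵇ r) ∧ memberAt v w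
      ∎
    where
    open ≡-Reasoning
    w : Word
    w = toWord S

starSize-mono : ∀ {n r} (u v : V n) → Star n r (memberAt u) ↪ Star n r (memberAt v) → starSize n r u ≤ starSize n r v
starSize-mono {n} {r} u v f = begin
  starSize n r u                                     ≡⟨ starSize-≡ n r u ⟩
  count (does ∘ star? n r (memberAt u)) (allWords n) ≤⟨ count-≤-↪ (star? n r _) (star? n r _) f (allWords-unique n) image∈ ⟩
  count (does ∘ star? n r (memberAt v)) (allWords n) ≡⟨ sym (starSize-≡ n r v) ⟩
  starSize n r v                                     ∎
  where
  open ≤-Reasoning
  image∈ : ∀ {w} → w ∈ allWords n → Star n r (memberAt u) w → to f w ∈ allWords n
  image∈ _ star = ∈-allWords (proj₁ (to-preserves f star))

position : ∀ {n} → V n → Fin n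
position (x i) = i
position (p i) = i

vertex↪pendant : ∀ {n r} (v : V n) → Star n r (memberAt v) ↪ Star n r (pAt (toℕ (position v)))
vertex↪pendant (x i) = xAt↪pAt (toℕ i)
vertex↪pendant (p i) = ↪-refl

theorem5 : (m r : ℕ) → 1 ≤ r → r ≤ suc (suc m) → (v : V (suc (suc m))) →
    (starSize (suc (suc m)) r v ≤ starSize (suc (suc m)) r (p (suc zero)))
    × (starSize (suc (suc m)) r v ≤ starSize (suc (suc m)) r (p (inject₁ (fromℕ m))))
theorem5 m r _ _ v =
    starSize-mono v (p (suc zero)) (↪-trans (vertex↪pendant v) (pAt↪second 2≤n))
  , starSize-mono v (p (inject₁ (fromℕ m)))
      (↪-trans (vertex↪pendant v) (↪-trans (pAt↪mirror mirrored) (↪-trans (pAt↪second 2≤n) secondToLast)))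
  where
  n : ℕ
  n = suc (suc m)
  2≤n : 2 ≤ n
  2≤n = s≤s (s≤s z≤n)
  i : ℕ
  i = toℕ (position v)
  mirrored : suc (i + (n ∸ suc i)) ≡ n
  mirrored = m+[n∸m]≡n (toℕ<n (position v))
  secondToLast : Star n r (pAt 1) ↪ Star n r (memberAt (p (inject₁ (fromℕ m))))
  secondToLast = subst (λ j → Star n r (pAt 1) ↪ Star n r (pAt j))
    (sym (trans (toℕ-inject₁ (fromℕ m)) (toℕ-fromℕ m))) (pAt↪mirror refl)
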